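{- Let $Q$ be a finite set, $F\subseteq Q$ and $\iota\in Q$, and let $\sigma$ be a finite purely relational signature. There exist first-order formulas $\mathrm{path}_{(Q,p,q)}$ (for $p,q\in Q$) and $\mathrm{mchain}_{(Q,\iota,F)}$ of the signature $\sigma$, with free set variables $T_{p,q}$ ($p,q\in Q$), such that for every $\sigma$-structure $\mathfrak A$ with universe $A$ and every automaton $\mathcal M=(Q,B,\iota,\delta,F)$ with $B\subseteq A$ and transition matrix $T$: (1) $(\mathfrak A,T)\models^{\mathrm w}\mathrm{path}_{(Q,p,q)}$ iff there exists a word $w$ with $\delta(p,w)=q$; (2) $(\mathfrak A,T)\models^{\mathrm w}\mathrm{mchain}_{(Q,\iota,F)}$ iff $L(\mathcal M)$ is a multichain.
   Context: Automata are complete deterministic finite automata $(Q,B,\iota,\delta,F)$ with finite alphabet $B$, $\delta:Q\times B\to Q$ extended to words. The transition matrix is $T=(T_{p,q})_{p,q\in Q}$ with $T_{p,q}=\{b\in B\mid\delta(p,b)=q\}$; in $(\mathfrak A,T)$ the set variable $T_{p,q}$ is interpreted by this set. First-order formulas with free set variables may use atoms $x\in T_{p,q}$ but no set quantifiers. $\models^{\mathrm w}$ is MSO satisfaction with set quantifiers ranging over finite sets. A multichain is a finite union of chains with respect to the prefix order on finite words (a chain being a set of words linearly ordered by the prefix relation). -}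

module Defs where

open import Level using (0ℓ)
open import Data.Nat using (ℕ; suc)
open import Data.Fin using (Fin; zero; suc)
open import Data.Fin.Subset using (Subset; _∈_)
open import Data.Vec using (Vec; map; lookup)
open import Data.List using (List; []; _∷_; _++_)
open import Data.Product using (Σ; Σ-syntax; _×_)
open import Data.Sum using (_⊎_)
open import Data.Empty using (⊥)
open import Data.Unit using (⊤)
open import Function.Definitions using (Injective)
open import Function.Bundles using (_⇔_)
open import Relation.Binary.PropositionalEquality using (_≡_)

record Signature : Set where
  field
    nrel  : ℕ
    arity : Fin nrel → ℕ
open Signature public

record Structure (σ : Signature) : Set₁ where
  field
    Univ : Set
    rel  : (r : Fin (nrel σ)) → Vec Univ (arity σ r) → Set
open Structure public

-- First-order formulas of signature σ with free set variables T p q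
-- (p q : Fin k) and n free first-order (de Bruijn) variables.
-- No set quantifiers.

data Formula (σ : Signature) (k : ℕ) : ℕ → Set where
  relf  : ∀ {n} (r : Fin (nrel σ)) → Vec (Fin n) (arity σ r) → Formula σ k n
  eq    : ∀ {n} → Fin n → Fin n → Formula σ k n
  memT  : ∀ {n} → Fin n → (p q : Fin k) → Formula σ k n
  ⊤f ⊥f : ∀ {n} → Formula σ k n
  ¬f    : ∀ {n} → Formula σ k n → Formula σ k n
  _∧f_ _∨f_ _⇒f_ : ∀ {n} → Formula σ k n → Formula σ k n → Formula σ k n
  ∃f ∀f : ∀ {n} → Formula σ k (suc n) → Formula σ k n

extend : ∀ {A : Set} {n} → A → (Fin n → A) → Fin (suc n) → A
extend a env zero    = a
extend a env (suc i) = env i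

-- Satisfaction in (𝔄, T), T an interpretation of the set variables.
-- Since there are no set quantifiers, weak MSO satisfaction ⊨ʷ coincides
-- with this first-order satisfaction.
Sat : ∀ {σ k n} (𝔄 : Structure σ) → (Fin k → Fin k → Univ 𝔄 → Set) →
      (Fin n → Univ 𝔄) → Formula σ k n → Set
Sat 𝔄 T env (relf r xs)  = rel 𝔄 r (map env xs)
Sat 𝔄 T env (eq x y)    = env x ≡ env y
Sat 𝔄 T env (memT x p q) = T p q (env x)
Sat 𝔄 T env ⊤f          = ⊤
Sat 𝔄 T env ⊥f          = ⊥
Sat 𝔄 T env (¬f φ)      = Sat 𝔄 T env φ → ⊥
Sat 𝔄 T env (φ ∧f ψ)    = Sat 𝔄 T env φ × Sat 𝔄 T env ψ
Sat 𝔄 T env (φ ∨f ψ)    = Sat 𝔄 T env φ ⊎ Sat 𝔄 T env ψ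
Sat 𝔄 T env (φ ⇒f ψ)    = Sat 𝔄 T env φ → Sat 𝔄 T env ψ
Sat 𝔄 T env (∃f φ)      = Σ[ a ∈ Univ 𝔄 ] Sat 𝔄 T (extend a env) φ
Sat 𝔄 T env (∀f φ)      = (a : Univ 𝔄) → Sat 𝔄 T (extend a env) φ

emptyEnv : ∀ {A : Set} → Fin 0 → A
emptyEnv ()

_,_⊨ʷ_ : ∀ {σ k} (𝔄 : Structure σ) → (Fin k → Fin k → Univ 𝔄 → Set) →
         Formula σ k 0 → Set
𝔄 , T ⊨ʷ φ = Sat 𝔄 T emptyEnv φ

-- Complete DFAs with state set Q = Fin k, whose finite alphabet B is a
-- subset of the universe A: B is given as Fin m together with an
-- injective embedding into A.

record Automaton (k : ℕ) (A : Set) : Set where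
  field
    m      : ℕ
    emb    : Fin m → A
    emb-inj : Injective _≡_ _≡_ emb
    init   : Fin k
    δ      : Fin k → Fin m → Fin k
    final  : Subset k
open Automaton public

Word : ∀ {k A} → Automaton k A → Set
Word M = List (Fin (m M))

δ* : ∀ {k A} (M : Automaton k A) → Fin k → Word M → Fin k
δ* M p []      = p
δ* M p (b ∷ w) = δ* M (δ M p b) w

TransMatrix : ∀ {k A} (M : Automaton k A) → Fin k → Fin k → A → Set
TransMatrix M p q a = Σ[ b ∈ Fin (m M) ] (emb M b ≡ a × δ M p b ≡ q)

L : ∀ {k A} (M : Automaton k A) → Word M → Set
L M w = δ* M (init M) w ∈ final M

_≼_ : ∀ {X : Set} → List X → List X → Set
u ≼ v = Σ[ w ∈ _ ] (u ++ w ≡ v)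

IsChain : ∀ {X : Set} → (List X → Set) → Set
IsChain C = ∀ u v → C u → C v → (u ≼ v ⊎ v ≼ u)

IsMultichain : ∀ {X : Set} → (List X → Set) → Set₁
IsMultichain {X} S =
  Σ[ n ∈ ℕ ] Σ[ C ∈ (Fin n → List X → Set) ]
    ((∀ i → IsChain (C i)) × (∀ w → S w ⇔ (Σ[ i ∈ Fin n ] C i w)))

module Submission where

-- (1) path p q says "q is reachable from p by a word of length ≤ k",
--     built by unfolding one transition at a time (reach n).  This is
--     equivalent to plain reachability because every reachable state is
--     reachable by a short word: a word of length ≥ k revisits a state on
--     one of its prefixes (pigeonhole), and the loop can be cut out.
-- (2) L(M) is a multichain iff M has no *branching*: a reachable state s
--     with a non-empty loop s →x⋯→ s and a letter y ≠ x from which an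
--     accepting state is reachable.  A branching yields the infinite
--     antichain α (x c)ʲ y d (j ∈ ℕ) inside L(M), which no finite union
--     of chains can contain.  Conversely, without branching every accepted
--     word is either short (≤ k letters) or extends a short prefix that
--     reaches a loop, after which all accepted continuations are
--     comparable; so L(M) is covered by finitely many chains.
-- Since a branching is expressed by a first-order formula, mchain is its
-- negation.

open import Defs
open import Data.Nat using (ℕ; zero; suc; _≤_; _<_; z≤n; s≤s; s≤s⁻¹; _≤?_)
open import Data.Nat.Properties
  using (≤-trans; <⇒≤; ≰⇒>; <-≤-trans; n<1+n; +-monoʳ-≤; m≤n+m)
open import Data.Fin using (Fin; zero; suc; toℕ; _≟_)
open import Data.Fin.Properties using (pigeonhole; toℕ<n)
open import Data.Fin.Subset using (Subset; _∈_)
open import Data.Fin.Subset.Properties using (_∈?_)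
open import Data.List using (List; []; _∷_; _++_; take; drop; length; lookup; cartesianProductWith; allFin)
open import Data.List.Properties
  using (take++drop≡id; ++-assoc; ++-cancelˡ; ∷-injectiveˡ; ++-identityʳ; length-++; length-++-sucʳ)
import Data.List.Relation.Unary.Any as Any
open import Data.List.Relation.Unary.Any using (here; there)
open import Data.List.Relation.Unary.Any.Properties using (lookup-index)
open import Data.List.Membership.Propositional using () renaming (_∈_ to _∈ₗ_)
open import Data.List.Membership.Propositional.Properties using (∈-cartesianProductWith⁺; ∈-allFin)
open import Data.Product using (Σ; Σ-syntax; _×_; _,_; proj₁; proj₂)
import Data.Sum as Sum
open import Data.Sum using (_⊎_; inj₁; inj₂)
open import Data.Empty using (⊥; ⊥-elim)
open import Data.Unit using (tt)
open import Function using (_∘_)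
open import Function.Bundles using (_⇔_; mk⇔; Equivalence)
import Function.Properties.Equivalence as ⇔
open import Relation.Nullary using (Dec; yes; no; ¬_)
open import Relation.Binary.PropositionalEquality
  using (_≡_; _≢_; refl; sym; trans; cong; subst; module ≡-Reasoning)

open Equivalence using (to; from)

module _ {X : Set} where

  Comparable : List X → List X → Set
  Comparable u v = u ≼ v ⊎ v ≼ u

  comparable-++ : (p : List X) {u v : List X} →
                  Comparable u v → Comparable (p ++ u) (p ++ v)
  comparable-++ p = Sum.map prepend prepend
    where
    prepend : {u v : List X} → u ≼ v → (p ++ u) ≼ (p ++ v)
    prepend {u} (r , e) = r , trans (++-assoc p u r) (cong (p ++_) e)

  comparable-cancel : (p : List X) {u v : List X} →
                      Comparable (p ++ u) (p ++ v) → Comparable u v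
  comparable-cancel p = Sum.map cancel cancel
    where
    cancel : {u v : List X} → (p ++ u) ≼ (p ++ v) → u ≼ v
    cancel {u} (r , e) = r , ++-cancelˡ p _ _ (trans (sym (++-assoc p u r)) e)

  distinct-heads : ∀ {x y : X} {u v} → x ≢ y → ¬ Comparable (x ∷ u) (y ∷ v)
  distinct-heads x≢y (inj₁ (_ , e)) = x≢y (∷-injectiveˡ e)
  distinct-heads x≢y (inj₂ (_ , e)) = x≢y (sym (∷-injectiveˡ e))

  pump : List X → List X → ℕ → List X
  pump ℓ t zero    = t
  pump ℓ t (suc j) = ℓ ++ pump ℓ t j

  pump-antichain : ∀ {x y : X} {c d} → x ≢ y → ∀ {i j} → i < j →
                   ¬ Comparable (pump (x ∷ c) (y ∷ d) i) (pump (x ∷ c) (y ∷ d) j)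
  pump-antichain x≢y {zero}  {suc j} _         = distinct-heads (x≢y ∘ sym)
  pump-antichain x≢y {suc i} {suc j} (s≤s i<j) =
    pump-antichain x≢y i<j ∘ comparable-cancel (_ ∷ _)

  -- A multichain contains no infinite antichain: by pigeonhole two of the
  -- words W 0, …, W n fall into the same one of the n chains.
  multichain-no-antichain : {S : List X → Set} → IsMultichain S →
    (W : ℕ → List X) → (∀ j → S (W j)) →
    (∀ {i j} → i < j → ¬ Comparable (W i) (W j)) → ⊥
  multichain-no-antichain (n , C , chain , cover) W inS antichain =
    let i , j , i<j , same = pigeonhole (n<1+n n) (proj₁ ∘ member) in
    antichain i<j (chain (proj₁ (member i)) (W (toℕ i)) (W (toℕ j))
      (proj₂ (member i)) (subst (λ c → C c (W (toℕ j))) (sym same) (proj₂ (member j))))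
    where
    member : (j : Fin (suc n)) → Σ[ c ∈ Fin n ] C c (W (toℕ j))
    member j = to (cover (W (toℕ j))) (inS (toℕ j))

  multichain-from-list : {I : Set} {S : List X → Set} (ps : List I)
    (C : I → List X → Set) → (∀ p → IsChain (C p)) →
    (∀ w → S w → Σ[ p ∈ I ] (p ∈ₗ ps × C p w)) →
    (∀ p w → C p w → S w) → IsMultichain S
  multichain-from-list ps C chain cover sound =
    length ps , C ∘ lookup ps , chain ∘ lookup ps ,
    λ w → mk⇔ (index w) (λ (i , c) → sound (lookup ps i) w c)
    where
    index : ∀ w → _ → Σ[ i ∈ Fin (length ps) ] C (lookup ps i) w
    index w Sw with p , p∈ps , c ← cover w Sw =
      Any.index p∈ps , subst (λ q → C q w) (lookup-index p∈ps) c

  wordsUpTo : List X → ℕ → List (List X)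
  wordsUpTo xs zero    = [] ∷ []
  wordsUpTo xs (suc n) = [] ∷ cartesianProductWith _∷_ xs (wordsUpTo xs n)

  wordsUpTo-complete : {xs : List X} → (∀ x → x ∈ₗ xs) →
                       ∀ n w → length w ≤ n → w ∈ₗ wordsUpTo xs n
  wordsUpTo-complete all zero    []      _         = here refl
  wordsUpTo-complete all (suc n) []      _         = here refl
  wordsUpTo-complete all (suc n) (x ∷ w) (s≤s w≤n) =
    there (∈-cartesianProductWith⁺ _∷_ (all x) (wordsUpTo-complete all n w w≤n))

  split-at-prefixes : ∀ a b (w : List X) → a < b → b ≤ length w →
    Σ[ u ∈ List X ] Σ[ x ∈ X ] Σ[ c ∈ List X ] Σ[ v ∈ List X ]
      (w ≡ u ++ x ∷ c ++ v) × (take a w ≡ u) × (take b w ≡ u ++ x ∷ c) × (length u ≡ a)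
  split-at-prefixes zero (suc b) (x ∷ w) _ _ =
    [] , x , take b w , drop b w , cong (x ∷_) (sym (take++drop≡id b w)) , refl , refl , refl
  split-at-prefixes (suc a) (suc b) (y ∷ w) (s≤s a<b) (s≤s b≤|w|)
    with u , x , c , v , w≡ , takeA , takeB , |u| ← split-at-prefixes a b w a<b b≤|w| =
    y ∷ u , x , c , v , cong (y ∷_) w≡ , cong (y ∷_) takeA , cong (y ∷_) takeB , cong suc |u|

  repeated-prefix : ∀ {k} (f : List X → Fin k) (w : List X) → k ≤ length w →
    Σ[ u ∈ List X ] Σ[ x ∈ X ] Σ[ c ∈ List X ] Σ[ v ∈ List X ]
      (w ≡ u ++ x ∷ c ++ v) × (f (u ++ x ∷ c) ≡ f u) × (length u < k)
  repeated-prefix {k} f w k≤|w|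
    with i , j , i<j , same ← pigeonhole (n<1+n k) (λ i → f (take (toℕ i) w))
    with u , x , c , v , w≡ , takeI , takeJ , |u|
         ← split-at-prefixes (toℕ i) (toℕ j) w i<j (≤-trans (s≤s⁻¹ (toℕ<n j)) k≤|w|) =
    u , x , c , v , w≡ , loop , subst (_< k) (sym |u|) (<-≤-trans i<j (s≤s⁻¹ (toℕ<n j)))
    where
    open ≡-Reasoning
    loop : f (u ++ x ∷ c) ≡ f u
    loop = begin
      f (u ++ x ∷ c)       ≡⟨ cong f takeJ ⟨
      f (take (toℕ j) w)   ≡⟨ same ⟨
      f (take (toℕ i) w)   ≡⟨ cong f takeI ⟩
      f u                  ∎

  remove-infix-< : (u : List X) (x : X) (c v : List X) →
                   length (u ++ v) < length (u ++ x ∷ c ++ v)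
  remove-infix-< u x c v
    rewrite length-++-sucʳ u x (c ++ v) | length-++ u {v} | length-++ u {c ++ v} | length-++ c {v} =
    s≤s (+-monoʳ-≤ (length u) (m≤n+m (length v) (length c)))

module _ {k : ℕ} {A : Set} (M : Automaton k A) where

  Reachable : Fin k → Fin k → Set
  Reachable p q = Σ[ w ∈ Word M ] δ* M p w ≡ q

  δ*-++ : ∀ p (u v : Word M) → δ* M p (u ++ v) ≡ δ* M (δ* M p u) v
  δ*-++ p []      v = refl
  δ*-++ p (b ∷ u) v = δ*-++ (δ M p b) u v

  reachable-step : ∀ {p q} → Reachable p q → ∀ a → Reachable p (δ M q a)
  reachable-step {p} (w , e) a =
    w ++ a ∷ [] , trans (δ*-++ p w (a ∷ [])) (cong (λ r → δ M r a) e)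

  pump-down : ∀ p (u : Word M) x c v → δ* M p (u ++ x ∷ c) ≡ δ* M p u →
              δ* M p (u ++ x ∷ c ++ v) ≡ δ* M p (u ++ v)
  pump-down p u x c v loop = begin
    δ* M p (u ++ (x ∷ c) ++ v)       ≡⟨ cong (δ* M p) (++-assoc u (x ∷ c) v) ⟨
    δ* M p ((u ++ x ∷ c) ++ v)       ≡⟨ δ*-++ p (u ++ x ∷ c) v ⟩
    δ* M (δ* M p (u ++ x ∷ c)) v     ≡⟨ cong (λ q → δ* M q v) loop ⟩
    δ* M (δ* M p u) v                ≡⟨ δ*-++ p u v ⟨
    δ* M p (u ++ v)                  ∎
    where open ≡-Reasoning

  shorten : ∀ N p (w : Word M) → length w < N →
            Σ[ w′ ∈ Word M ] (length w′ ≤ k × δ* M p w′ ≡ δ* M p w)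
  shorten (suc N) p w |w|<N with length w ≤? k
  ... | yes |w|≤k = w , |w|≤k , refl
  ... | no  |w|≰k
    with u , x , c , v , refl , loop , _ ← repeated-prefix (δ* M p) w (<⇒≤ (≰⇒> |w|≰k))
    with w′ , |w′|≤k , same ←
         shorten N p (u ++ v) (<-≤-trans (remove-infix-< u x c v) (s≤s⁻¹ |w|<N)) =
    w′ , |w′|≤k , trans same (sym (pump-down p u x c v loop))

  reachable-short : ∀ {p q} → Reachable p q → Σ[ w ∈ Word M ] (length w ≤ k × δ* M p w ≡ q)
  reachable-short {p} (w , e) with w′ , |w′|≤k , same ← shorten (suc (length w)) p w (n<1+n _) =
    w′ , |w′|≤k , trans same e

  AcceptsFrom : Fin k → Set
  AcceptsFrom q = Σ[ w ∈ Word M ] δ* M q w ∈ final M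

  OnCycle : Fin k → Set
  OnCycle s = Σ[ x ∈ Fin (m M) ] Reachable (δ M s x) s

  rotate : ∀ {s x} → Reachable (δ M s x) s → OnCycle (δ M s x)
  rotate {x = x} ([]    , e) = x , [] , cong (λ q → δ M q x) e
  rotate         (z ∷ c , e) = z , reachable-step (c , e) _

  record Branching : Set where
    field
      s         : Fin k
      reachable : Reachable (init M) s
      x y       : Fin (m M)
      distinct  : x ≢ y
      loop      : Reachable (δ M s x) s
      accepting : AcceptsFrom (δ M s y)

  δ*-pump : ∀ {s} (ℓ t : Word M) → δ* M s ℓ ≡ s → ∀ j → δ* M s (pump ℓ t j) ≡ δ* M s t
  δ*-pump ℓ t loop zero    = refl
  δ*-pump {s} ℓ t loop (suc j) =
    trans (δ*-++ s ℓ (pump ℓ t j)) (trans (cong (λ q → δ* M q (pump ℓ t j)) loop) (δ*-pump ℓ t loop j))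

  branching⇒¬multichain : Branching → ¬ IsMultichain (L M)
  branching⇒¬multichain b mc =
    multichain-no-antichain mc W accepted
      (λ i<j → pump-antichain distinct i<j ∘ comparable-cancel α)
    where
    open Branching b
    α c d : Word M
    α = proj₁ reachable
    c = proj₁ loop
    d = proj₁ accepting
    ℓ : Word M
    ℓ = x ∷ c
    W : ℕ → Word M
    W j = α ++ pump ℓ (y ∷ d) j
    accepted : ∀ j → L M (W j)
    accepted j = subst (_∈ final M) (sym (begin
      δ* M (init M) (W j)                        ≡⟨ δ*-++ (init M) α _ ⟩
      δ* M (δ* M (init M) α) (pump ℓ (y ∷ d) j)  ≡⟨ cong (λ q → δ* M q (pump ℓ (y ∷ d) j)) (proj₂ reachable) ⟩
      δ* M s (pump ℓ (y ∷ d) j)                  ≡⟨ δ*-pump ℓ (y ∷ d) (proj₂ loop) j ⟩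
      δ* M (δ M s y) d                           ∎)) (proj₂ accepting)
      where open ≡-Reasoning

  -- Without branching, from a reachable state on a loop all accepted
  -- continuations are comparable: at every step both must follow the
  -- (unique) first letter of the loop, which again leads to such a state.
  continuations-comparable : ¬ Branching → ∀ s → Reachable (init M) s → OnCycle s →
    ∀ (u v : Word M) → δ* M s u ∈ final M → δ* M s v ∈ final M → Comparable u v
  continuations-comparable nb s r cyc []      v       _  _  = inj₁ (v , refl)
  continuations-comparable nb s r cyc (a ∷ u) []      _  _  = inj₂ (a ∷ u , refl)
  continuations-comparable nb s r (x , loop) (a ∷ u) (b ∷ v) acc-u acc-v with a ≟ x | b ≟ x
  ... | no a≢x   | _        = ⊥-elim (nb (record
    { s = s ; reachable = r ; x = x ; y = a ; distinct = a≢x ∘ sym ; loop = loop ; accepting = u , acc-u }))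
  ... | yes _    | no b≢x   = ⊥-elim (nb (record
    { s = s ; reachable = r ; x = x ; y = b ; distinct = b≢x ∘ sym ; loop = loop ; accepting = v , acc-v }))
  ... | yes refl | yes refl =
    comparable-++ (a ∷ []) (continuations-comparable nb (δ M s a)
      (reachable-step r a) (rotate loop) u v acc-u acc-v)

  ChainFrom : Word M → Word M → Set
  ChainFrom p w = L M w × (p ≡ w ⊎ (p ≼ w × OnCycle (δ* M (init M) p)))

  chainFrom-isChain : ¬ Branching → ∀ p → IsChain (ChainFrom p)
  chainFrom-isChain nb p u v (_ , inj₁ refl) (_ , inj₁ refl) = inj₁ ([] , ++-identityʳ p)
  chainFrom-isChain nb p u v (_ , inj₁ refl) (_ , inj₂ (p≼v , _)) = inj₁ p≼v
  chainFrom-isChain nb p u v (_ , inj₂ (p≼u , _)) (_ , inj₁ refl) = inj₂ p≼u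
  chainFrom-isChain nb p u v (Lu , inj₂ ((r , refl) , cyc)) (Lv , inj₂ ((r′ , refl) , _)) =
    comparable-++ p (continuations-comparable nb (δ* M (init M) p) (p , refl) cyc r r′
      (subst (_∈ final M) (δ*-++ (init M) p r) Lu) (subst (_∈ final M) (δ*-++ (init M) p r′) Lv))

  shortWords : List (Word M)
  shortWords = wordsUpTo (allFin (m M)) k

  -- Every accepted word lies in the chain of a short prefix: itself if
  -- it is short, otherwise a prefix of length < k followed by a loop.
  covered : ∀ w → L M w → Σ[ p ∈ Word M ] (p ∈ₗ shortWords × ChainFrom p w)
  covered w Lw with length w ≤? k
  ... | yes |w|≤k = w , wordsUpTo-complete ∈-allFin k w |w|≤k , Lw , inj₁ refl
  ... | no  |w|≰k
    with u , x , c , v , refl , loop , |u|<k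
         ← repeated-prefix (δ* M (init M)) w (<⇒≤ (≰⇒> |w|≰k)) =
    u , wordsUpTo-complete ∈-allFin k u (<⇒≤ |u|<k) , Lw ,
    inj₂ ((x ∷ c ++ v , refl) , x , c , trans (sym (δ*-++ (init M) u (x ∷ c))) loop)

  multichain⇔¬branching : IsMultichain (L M) ⇔ (¬ Branching)
  multichain⇔¬branching = mk⇔ (λ mc b → branching⇒¬multichain b mc) λ nb →
    multichain-from-list shortWords ChainFrom (chainFrom-isChain nb) covered (λ _ _ → proj₁)

-- The formulas.  They are stated for any number n of free first-order
-- variables, since they are nested under quantifiers.
module _ {σ : Signature} {k : ℕ} where

  ⋁ : ∀ {n j} → (Fin j → Formula σ k n) → Formula σ k n
  ⋁ {j = zero}  φ = ⊥f
  ⋁ {j = suc j} φ = φ zero ∨f ⋁ (φ ∘ suc)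

  ⌜_⌝ : ∀ {n} {P : Set} → Dec P → Formula σ k n
  ⌜ yes _ ⌝ = ⊤f
  ⌜ no  _ ⌝ = ⊥f

  after : ∀ {n} → Fin n → Fin k → (Fin k → Formula σ k n) → Formula σ k n
  after v p φ = ⋁ (λ r → memT v p r ∧f φ r)

  reach : ∀ {n} → ℕ → Fin k → Fin k → Formula σ k n
  reach zero    p q = ⌜ p ≟ q ⌝
  reach (suc l) p q = ⌜ p ≟ q ⌝ ∨f ∃f (after zero p (λ r → reach l r q))

  -- k steps suffice for reachability in a k-state automaton.
  path : ∀ {n} → Fin k → Fin k → Formula σ k n
  path p q = reach k p q

  acceptsFrom : ∀ {n} → Subset k → Fin k → Formula σ k n
  acceptsFrom F q = ⋁ (λ f → ⌜ f ∈? F ⌝ ∧f path q f)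

  -- "s is reachable from ι and has two different letters a, a′, where a
  --  leads back to s and a′ leads to a state accepting with respect to F."
  branchesAt : ∀ {n} → Fin k → Subset k → Fin k → Formula σ k n
  branchesAt ι F s = path ι s ∧f ∃f (∃f (¬f (eq (suc zero) zero)
    ∧f (after (suc zero) s (λ r → path r s) ∧f after zero s (acceptsFrom F))))

  branching : ∀ {n} → Fin k → Subset k → Formula σ k n
  branching ι F = ⋁ (branchesAt ι F)

module _ {σ : Signature} {k : ℕ} (𝔄 : Structure σ) (M : Automaton k (Univ 𝔄)) where

  infix 4 _⊨_
  _⊨_ : ∀ {n} → (Fin n → Univ 𝔄) → Formula σ k n → Set
  env ⊨ φ = Sat 𝔄 (TransMatrix M) env φ

  module _ {n : ℕ} {env : Fin n → Univ 𝔄} where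

    Sat-⋁ : ∀ {j} (φ : Fin j → Formula σ k n) → env ⊨ ⋁ φ ⇔ (Σ[ i ∈ Fin j ] env ⊨ φ i)
    Sat-⋁ {zero}  φ = mk⇔ (λ ()) (λ ())
    Sat-⋁ {suc j} φ = mk⇔ sound complete
      where
      sound : env ⊨ ⋁ φ → Σ[ i ∈ Fin (suc j) ] env ⊨ φ i
      sound (inj₁ sat) = zero , sat
      sound (inj₂ sat) with i , sat′ ← to (Sat-⋁ (φ ∘ suc)) sat = suc i , sat′
      complete : Σ[ i ∈ Fin (suc j) ] env ⊨ φ i → env ⊨ ⋁ φ
      complete (zero  , sat) = inj₁ sat
      complete (suc i , sat) = inj₂ (from (Sat-⋁ (φ ∘ suc)) (i , sat))

    Sat-⌜⌝ : {P : Set} (d : Dec P) → env ⊨ ⌜ d ⌝ ⇔ P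
    Sat-⌜⌝ (yes p) = mk⇔ (λ _ → p) (λ _ → tt)
    Sat-⌜⌝ (no ¬p) = mk⇔ ⊥-elim ¬p

    Sat-after : ∀ v p (φ : Fin k → Formula σ k n) →
      env ⊨ after v p φ ⇔ (Σ[ b ∈ Fin (m M) ] (emb M b ≡ env v × env ⊨ φ (δ M p b)))
    Sat-after v p φ = mk⇔ sound complete
      where
      sound : env ⊨ after v p φ → Σ[ b ∈ Fin (m M) ] (emb M b ≡ env v × env ⊨ φ (δ M p b))
      sound sat with r , (b , eb , δpb≡r) , sat′ ← to (Sat-⋁ (λ r → memT v p r ∧f φ r)) sat =
        b , eb , subst (λ r → env ⊨ φ r) (sym δpb≡r) sat′
      complete : Σ[ b ∈ Fin (m M) ] (emb M b ≡ env v × env ⊨ φ (δ M p b)) → env ⊨ after v p φ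
      complete (b , eb , sat) = from (Sat-⋁ _) (δ M p b , (b , eb , refl) , sat)

  reach-sound : ∀ {n} {env : Fin n → Univ 𝔄} l p q → env ⊨ reach l p q →
                Σ[ w ∈ Word M ] (length w ≤ l × δ* M p w ≡ q)
  reach-sound zero    p q sat        = [] , z≤n , to (Sat-⌜⌝ (p ≟ q)) sat
  reach-sound (suc l) p q (inj₁ sat) = [] , z≤n , to (Sat-⌜⌝ (p ≟ q)) sat
  reach-sound (suc l) p q (inj₂ (_ , sat))
    with b , _ , sat′ ← to (Sat-after zero p _) sat
    with w , |w|≤l , e ← reach-sound l (δ M p b) q sat′ =
    b ∷ w , s≤s |w|≤l , e

  reach-complete : ∀ {n} {env : Fin n → Univ 𝔄} l p q →
                   Σ[ w ∈ Word M ] (length w ≤ l × δ* M p w ≡ q) → env ⊨ reach l p q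
  reach-complete zero    p q ([] , _ , e) = from (Sat-⌜⌝ (p ≟ q)) e
  reach-complete (suc l) p q ([] , _ , e) = inj₁ (from (Sat-⌜⌝ (p ≟ q)) e)
  reach-complete (suc l) p q (b ∷ w , s≤s |w|≤l , e) =
    inj₂ (emb M b , from (Sat-after zero p _) (b , refl , reach-complete l (δ M p b) q (w , |w|≤l , e)))

  Sat-path : ∀ {n} {env : Fin n → Univ 𝔄} p q → env ⊨ path p q ⇔ Reachable M p q
  Sat-path p q = mk⇔
    (λ sat → let w , _ , e = reach-sound k p q sat in w , e)
    (reach-complete k p q ∘ reachable-short M)

  Sat-acceptsFrom : ∀ {n} {env : Fin n → Univ 𝔄} q →
                    env ⊨ acceptsFrom (final M) q ⇔ AcceptsFrom M q
  Sat-acceptsFrom {env = env} q = mk⇔ sound complete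
    where
    sound : env ⊨ acceptsFrom (final M) q → AcceptsFrom M q
    sound sat with f , f∈F , reach-f ← to (Sat-⋁ (λ f → ⌜ f ∈? final M ⌝ ∧f path q f)) sat
      with w , e ← to (Sat-path q f) reach-f =
      w , subst (_∈ final M) (sym e) (to (Sat-⌜⌝ (f ∈? final M)) f∈F)
    complete : AcceptsFrom M q → env ⊨ acceptsFrom (final M) q
    complete (w , accepted) = from (Sat-⋁ _)
      (δ* M q w , from (Sat-⌜⌝ (_ ∈? final M)) accepted , from (Sat-path q _) (w , refl))

  -- The two quantified
  -- elements are letters because T_{p,q} ⊆ B, and they are distinct
  -- letters because B embeds injectively into the universe.
  Sat-branching : ∀ {n} {env : Fin n → Univ 𝔄} →
                  env ⊨ branching (init M) (final M) ⇔ Branching M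
  Sat-branching {env = env} = mk⇔ sound complete
    where
    sound : env ⊨ branching (init M) (final M) → Branching M
    sound sat
      with s , reach-s , a , a′ , a≢a′ , loop-sat , accept-sat ← to (Sat-⋁ (branchesAt (init M) (final M))) sat
      with x , ex , loop-path ← to (Sat-after (suc zero) s (λ r → path r s)) loop-sat
      with y , ey , accept-y ← to (Sat-after zero s (acceptsFrom (final M))) accept-sat =
      record
        { s = s ; reachable = to (Sat-path _ _) reach-s ; x = x ; y = y
        ; distinct  = λ x≡y → a≢a′ (trans (sym ex) (trans (cong (emb M) x≡y) ey))
        ; loop      = to (Sat-path _ _) loop-path
        ; accepting = to (Sat-acceptsFrom _) accept-y }
    complete : Branching M → env ⊨ branching (init M) (final M)
    complete b = from (Sat-⋁ (branchesAt (init M) (final M)))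
      ( s , from (Sat-path _ _) reachable , emb M x , emb M y , distinct ∘ emb-inj M
      , from (Sat-after (suc zero) s (λ r → path r s)) (x , refl , from (Sat-path _ _) loop)
      , from (Sat-after zero s (acceptsFrom (final M))) (y , refl , from (Sat-acceptsFrom _) accepting))
      where open Branching b

lemma4p1 : (k : ℕ) (σ : Signature) →
    Σ[ path ∈ (Fin k → Fin k → Formula σ k 0) ]
      ((∀ (p q : Fin k) (𝔄 : Structure σ) (M : Automaton k (Univ 𝔄)) →
          (𝔄 , TransMatrix M ⊨ʷ path p q) ⇔ (Σ[ w ∈ Word M ] δ* M p w ≡ q))
      × (∀ (ι : Fin k) (F : Subset k) →
          Σ[ mchain ∈ Formula σ k 0 ]
            (∀ (𝔄 : Structure σ) (M : Automaton k (Univ 𝔄)) →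
              init M ≡ ι → final M ≡ F →
              (𝔄 , TransMatrix M ⊨ʷ mchain) ⇔ IsMultichain (L M))))
lemma4p1 k σ =
  path , (λ p q 𝔄 M → Sat-path 𝔄 M p q) ,
  λ ι F → ¬f (branching ι F) , λ where
    𝔄 M refl refl → ⇔.trans (¬-cong (Sat-branching 𝔄 M)) (⇔.sym (multichain⇔¬branching M))
  where
  ¬-cong : ∀ {P Q : Set} → P ⇔ Q → (¬ P) ⇔ (¬ Q)
  ¬-cong P⇔Q = mk⇔ (λ ¬p → ¬p ∘ from P⇔Q) (λ ¬q → ¬q ∘ to P⇔Q)
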